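{- The $4$-wheel $W_4:=C_4\vee K_1$ is degree-swappable.
   Context: $C_4\vee K_1$ is the graph obtained from a 4-cycle by adding a vertex adjacent to all four cycle vertices. A list-assignment $L$ is a degree-assignment if $|L(v)|=d(v)$ for all $v$. An $L$-coloring is a proper coloring $\varphi$ with $\varphi(v)\in L(v)$. An $\alpha,\beta$-Kempe swap at $u$ (with $\varphi(u)\in\{\alpha,\beta\}$) interchanges $\alpha$ and $\beta$ on the component containing $u$ of the subgraph induced by vertices colored $\alpha$ or $\beta$; it is $L$-valid if the result is again an $L$-coloring. Two $L$-colorings are $L$-equivalent if one is obtained from the other by a sequence of $L$-valid Kempe swaps. A graph is $L$-swappable if it has an $L$-coloring and all its $L$-colorings are pairwise $L$-equivalent; it is degree-swappable if it is $L$-swappable for every degree-assignment $L$. -}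

module Defs where

open import Data.Nat using (ℕ; zero; suc; _≟_)
open import Data.Fin using (Fin; zero; suc)
open import Data.Bool using (Bool; true; false; T)
open import Data.List using (List; length; filter; allFin)
open import Data.List.Membership.Propositional using (_∈_)
open import Data.List.Relation.Unary.Unique.Propositional using (Unique)
open import Data.Product using (Σ; ∃; _×_; _,_)
open import Data.Sum using (_⊎_)
open import Relation.Nullary using (¬_)
open import Relation.Nullary.Decidable using (Dec; yes; no)
open import Relation.Binary.PropositionalEquality using (_≡_; _≢_)
open import Data.Bool using (T?)

-- Finite simple graphs on vertex set Fin n, given by a Boolean
-- adjacency function (assumed symmetric and irreflexive where used).

record Graph : Set where
  field
    n   : ℕ
    adj : Fin n → Fin n → Bool

module _ (G : Graph) where
  open Graph G

  Adj : Fin n → Fin n → Set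
  Adj u v = T (adj u v)

  deg : Fin n → ℕ
  deg v = length (filter (λ w → T? (adj v w)) (allFin n))

  ListAssignment : Set
  ListAssignment = Fin n → List ℕ

  IsListAssignment : ListAssignment → Set
  IsListAssignment L = ∀ v → Unique (L v)

  IsDegreeAssignment : ListAssignment → Set
  IsDegreeAssignment L = IsListAssignment L × (∀ v → length (L v) ≡ deg v)

  Colouring : Set
  Colouring = Fin n → ℕ

  IsLColouring : ListAssignment → Colouring → Set
  IsLColouring L φ = (∀ v → φ v ∈ L v) × (∀ u v → Adj u v → φ u ≢ φ v)

  -- v lies in the component containing u of the subgraph induced by
  -- the vertices coloured α or β under φ
  data InComp (φ : Colouring) (α β : ℕ) (u : Fin n) : Fin n → Set where
    here : (φ u ≡ α ⊎ φ u ≡ β) → InComp φ α β u u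
    step : ∀ {v w} → InComp φ α β u v → Adj v w →
           (φ w ≡ α ⊎ φ w ≡ β) → InComp φ α β u w

  swapCol : ℕ → ℕ → ℕ → ℕ
  swapCol α β c with c ≟ α
  ... | yes _ = β
  ... | no _ with c ≟ β
  ...   | yes _ = α
  ...   | no _ = c

  KempeSwap : Colouring → ℕ → ℕ → Fin n → Colouring → Set
  KempeSwap φ α β u ψ =
    (φ u ≡ α ⊎ φ u ≡ β) ×
    (∀ v → (InComp φ α β u v → ψ v ≡ swapCol α β (φ v)) ×
           (¬ InComp φ α β u v → ψ v ≡ φ v))

  LValidSwap : ListAssignment → Colouring → Colouring → Set
  LValidSwap L φ ψ =
    (Σ ℕ λ α → Σ ℕ λ β → Σ (Fin n) λ u → KempeSwap φ α β u ψ) × IsLColouring L ψ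

  data LEquiv (L : ListAssignment) : Colouring → Colouring → Set where
    done : ∀ {φ ψ} → (∀ v → φ v ≡ ψ v) → LEquiv L φ ψ
    swp  : ∀ {φ χ ψ} → LValidSwap L φ χ → LEquiv L χ ψ → LEquiv L φ ψ

  LSwappable : ListAssignment → Set
  LSwappable L =
    (∃ λ φ → IsLColouring L φ) ×
    (∀ φ ψ → IsLColouring L φ → IsLColouring L ψ → LEquiv L φ ψ)

  DegreeSwappable : Set
  DegreeSwappable = ∀ L → IsDegreeAssignment L → LSwappable L

-- The 4-wheel W₄ = C₄ ∨ K₁ : cycle 0-1-2-3-0, hub 4 adjacent to all.

w4adj : Fin 5 → Fin 5 → Bool
w4adj (suc (suc (suc (suc zero)))) (suc (suc (suc (suc zero)))) = false
w4adj (suc (suc (suc (suc zero)))) _ = true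
w4adj _ (suc (suc (suc (suc zero)))) = true
w4adj zero (suc zero) = true
w4adj (suc zero) zero = true
w4adj (suc zero) (suc (suc zero)) = true
w4adj (suc (suc zero)) (suc zero) = true
w4adj (suc (suc zero)) (suc (suc (suc zero))) = true
w4adj (suc (suc (suc zero))) (suc (suc zero)) = true
w4adj (suc (suc (suc zero))) zero = true
w4adj zero (suc (suc (suc zero))) = true
w4adj _ _ = false

W4 : Graph
W4 = record { n = 5 ; adj = w4adj }

module Submission where

-- Pick a colour α in the four-element hub list that is missing from L v₁.  The key
-- fact is flexibility: if the hub colour y is missing from the list of some rim vertex
-- w, then all L-colourings with hub colour y are L-equivalent, because w keeps three
-- usable colours and lets the rim be rearranged one vertex at a time by recolourings
-- and short Kempe swaps along the 4-cycle.  Since the hub dominates W₄, the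
-- (φ hub, α)-swap at the hub exchanges the two colours everywhere; it is L-valid once
-- every rim vertex coloured α also lists φ hub.  If some rim vertex w does not list
-- φ hub, flexibility first replaces φ by a colouring with the same hub colour that is
-- prepared for this swap; such a colouring exists because the 4-cycle is 2-choosable.
-- So every L-colouring is L-equivalent to one with hub colour α, and flexibility at v₁
-- connects any two of those.

open import Defs
open import Data.Bool using (T)
open import Data.Bool.Properties using () renaming (_≟_ to _≟ᵇ_)
open import Data.Empty using (⊥-elim)
open import Data.Fin using (Fin) renaming (_≟_ to _≟ᶠ_)
open import Data.Fin.Patterns using (0F; 1F; 2F; 3F; 4F)
open import Data.Fin.Permutation
  using (Permutation′; _⟨$⟩ʳ_; _⟨$⟩ˡ_; inverseˡ; inverseʳ; flip; transpose; _∘ₚ_)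
open import Data.Fin.Properties using (all?)
open import Data.List using (List; []; _∷_; _++_; length)
open import Data.List.Properties using (length-++-sucʳ)
open import Data.List.Membership.Propositional using (_∈_; _∉_)
open import Data.List.Membership.Propositional.Properties using (∈-∃++; ∈-++⁻; ∈-++⁺ˡ; ∈-++⁺ʳ)
open import Data.List.Relation.Unary.All as All using ()
open import Data.List.Relation.Unary.AllPairs using (_∷_)
open import Data.List.Relation.Unary.Any using (here; there)
open import Data.List.Relation.Unary.Unique.Propositional using (Unique)
open import Data.Nat using (ℕ; suc; _≟_; _<_; _≤_; s≤s; z≤n)
open import Data.Nat.Properties using (≤-refl)
open import Data.List.Membership.DecPropositional _≟_ using (_∈?_)
open import Data.Product using (∃; ∃₂; _×_; _,_; proj₁; proj₂)
open import Data.Sum using (_⊎_; inj₁; inj₂; [_,_])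
open import Data.Vec.Functional using (updateAt)
open import Data.Vec.Functional.Properties using (updateAt-updates; updateAt-minimal)
open import Function using (_∘_; const)
open import Relation.Nullary using (¬_; Dec; yes; no; contradiction)
open import Relation.Nullary.Decidable using (True; toWitness; _⊎-dec_)
open import Relation.Binary.PropositionalEquality
  using (_≡_; _≢_; refl; sym; trans; cong; cong₂; subst; subst₂; _≗_; ≢-sym)

infix 4 _∈⟨_,_⟩

_∈⟨_,_⟩ : ℕ → ℕ → ℕ → Set
c ∈⟨ α , β ⟩ = c ≡ α ⊎ c ≡ β

_∈⟨_,_⟩? : ∀ c α β → Dec (c ∈⟨ α , β ⟩)
c ∈⟨ α , β ⟩? = c ≟ α ⊎-dec c ≟ β

module KempeChains (G : Graph) (adj-sym : ∀ {u v} → Adj G u v → Adj G v u) where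
  open Graph G

  private
    variable
      α β c x : ℕ
      u v : Fin n
      L L′ : ListAssignment G
      φ φ′ ψ ψ′ : Colouring G

  swapCol-left : ∀ α β → swapCol G α β α ≡ β
  swapCol-left α β with α ≟ α
  ... | yes _ = refl
  ... | no α≢α = contradiction refl α≢α

  swapCol-right : ∀ α β → swapCol G α β β ≡ α
  swapCol-right α β with β ≟ α
  ... | yes β≡α = β≡α
  ... | no _ with β ≟ β
  ...   | yes _ = refl
  ...   | no β≢β = contradiction refl β≢β

  swapCol-other : ¬ c ∈⟨ α , β ⟩ → swapCol G α β c ≡ c
  swapCol-other {c} {α} {β} c∉ with c ≟ α
  ... | yes c≡α = contradiction (inj₁ c≡α) c∉
  ... | no _ with c ≟ β
  ...   | yes c≡β = contradiction (inj₂ c≡β) c∉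
  ...   | no _ = refl

  swapCol-∈ : c ∈⟨ α , β ⟩ → swapCol G α β c ∈⟨ α , β ⟩
  swapCol-∈ {α = α} {β} (inj₁ refl) = inj₂ (swapCol-left α β)
  swapCol-∈ {α = α} {β} (inj₂ refl) = inj₁ (swapCol-right α β)

  swapCol-involutive : ∀ α β c → swapCol G α β (swapCol G α β c) ≡ c
  swapCol-involutive α β c with c ∈⟨ α , β ⟩?
  ... | yes (inj₁ refl) = trans (cong (swapCol G c β) (swapCol-left c β)) (swapCol-right c β)
  ... | yes (inj₂ refl) = trans (cong (swapCol G α c) (swapCol-right α c)) (swapCol-left α c)
  ... | no c∉ = trans (cong (swapCol G α β) (swapCol-other c∉)) (swapCol-other c∉)

  swapCol-injective : ∀ α β {c c′} → swapCol G α β c ≡ swapCol G α β c′ → c ≡ c′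
  swapCol-injective α β {c} {c′} eq =
    trans (sym (swapCol-involutive α β c)) (trans (cong (swapCol G α β) eq) (swapCol-involutive α β c′))

  InComp-colour : InComp G φ α β u v → φ v ∈⟨ α , β ⟩
  InComp-colour (here p) = p
  InComp-colour (step _ _ p) = p

  InComp-resp : φ ≗ φ′ → InComp G φ α β u v → InComp G φ′ α β u v
  InComp-resp {α = α} {β = β} eq (here p) = here (subst (_∈⟨ α , β ⟩) (eq _) p)
  InComp-resp {α = α} {β = β} eq (step c a p) = step (InComp-resp eq c) a (subst (_∈⟨ α , β ⟩) (eq _) p)

  KempeSwap-sym : KempeSwap G φ α β u ψ → KempeSwap G ψ α β u φ
  KempeSwap-sym {φ} {α} {β} {u} {ψ} (φu , swapped) =
    InComp-colour (forward (here φu)) , λ v → inside , outside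
    where
    swapped-inside : ∀ {v} → InComp G φ α β u v → ψ v ≡ swapCol G α β (φ v)
    swapped-inside {v} = proj₁ (swapped v)

    unchanged-outside : ∀ {v} → ¬ InComp G φ α β u v → ψ v ≡ φ v
    unchanged-outside {v} = proj₂ (swapped v)

    ψ-coloured : ∀ {v} → InComp G φ α β u v → ψ v ∈⟨ α , β ⟩
    ψ-coloured c = subst (_∈⟨ α , β ⟩) (sym (swapped-inside c)) (swapCol-∈ (InComp-colour c))

    forward : ∀ {v} → InComp G φ α β u v → InComp G ψ α β u v
    forward (here p) = here (ψ-coloured (here p))
    forward (step c a p) = step (forward c) a (ψ-coloured (step c a p))

    backward : ∀ {v} → InComp G ψ α β u v → InComp G φ α β u v
    backward (here _) = here φu
    backward (step {w = w} c a p) with φ w ∈⟨ α , β ⟩?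
    ... | yes q = step (backward c) a q
    ... | no q = contradiction (subst (_∈⟨ α , β ⟩) (unchanged-outside (q ∘ InComp-colour)) p) q

    inside : ∀ {v} → InComp G ψ α β u v → φ v ≡ swapCol G α β (ψ v)
    inside {v} c =
      trans (sym (swapCol-involutive α β (φ v))) (cong (swapCol G α β) (sym (swapped-inside (backward c))))

    outside : ∀ {v} → ¬ InComp G ψ α β u v → φ v ≡ ψ v
    outside c∉ = sym (unchanged-outside (c∉ ∘ forward))

  KempeSwap-resp : φ ≗ φ′ → ψ ≗ ψ′ → KempeSwap G φ α β u ψ → KempeSwap G φ′ α β u ψ′
  KempeSwap-resp {φ} {φ′} {ψ} {ψ′} {α} {β} {u} φ≗ ψ≗ (φu , swapped) =
    subst (_∈⟨ α , β ⟩) (φ≗ u) φu , λ v →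
      (λ c → trans (sym (ψ≗ v))
                   (trans (proj₁ (swapped v) (InComp-resp (sym ∘ φ≗) c)) (cong (swapCol G α β) (φ≗ v)))) ,
      (λ c∉ → trans (sym (ψ≗ v)) (trans (proj₂ (swapped v) (c∉ ∘ InComp-resp φ≗)) (φ≗ v)))

  IsLColouring-resp : L ≗ L′ → φ ≗ φ′ → IsLColouring G L φ → IsLColouring G L′ φ′
  IsLColouring-resp L≗ φ≗ (mem , proper) =
    (λ v → subst₂ _∈_ (φ≗ v) (L≗ v) (mem v)) ,
    (λ u v a eq → proper u v a (trans (φ≗ u) (trans eq (sym (φ≗ v)))))

  LValidSwap-resp : L ≗ L′ → φ ≗ φ′ → ψ ≗ ψ′ → LValidSwap G L φ ψ → LValidSwap G L′ φ′ ψ′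
  LValidSwap-resp L≗ φ≗ ψ≗ ((α , β , u , s) , lc) =
    (α , β , u , KempeSwap-resp φ≗ ψ≗ s) , IsLColouring-resp L≗ ψ≗ lc

  LValidSwap-sym : IsLColouring G L φ → LValidSwap G L φ ψ → LValidSwap G L ψ φ
  LValidSwap-sym lc ((α , β , u , s) , _) = (α , β , u , KempeSwap-sym s) , lc

  LEquiv-resp : L ≗ L′ → φ ≗ φ′ → ψ ≗ ψ′ → LEquiv G L φ ψ → LEquiv G L′ φ′ ψ′
  LEquiv-resp L≗ φ≗ ψ≗ (done eq) = done λ v → trans (sym (φ≗ v)) (trans (eq v) (ψ≗ v))
  LEquiv-resp L≗ φ≗ ψ≗ (swp s e) =
    swp (LValidSwap-resp L≗ φ≗ (λ _ → refl) s) (LEquiv-resp L≗ (λ _ → refl) ψ≗ e)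

  LEquiv-trans : LEquiv G L φ φ′ → LEquiv G L φ′ ψ → LEquiv G L φ ψ
  LEquiv-trans (done eq) e = LEquiv-resp (λ _ → refl) (sym ∘ eq) (λ _ → refl) e
  LEquiv-trans (swp s e) e′ = swp s (LEquiv-trans e e′)

  LEquiv-colouring : IsLColouring G L φ → LEquiv G L φ ψ → IsLColouring G L ψ
  LEquiv-colouring lc (done eq) = IsLColouring-resp (λ _ → refl) eq lc
  LEquiv-colouring _ (swp (_ , lc) e) = LEquiv-colouring lc e

  LEquiv-sym : IsLColouring G L φ → LEquiv G L φ ψ → LEquiv G L ψ φ
  LEquiv-sym _ (done eq) = done (sym ∘ eq)
  LEquiv-sym lc (swp s e) =
    LEquiv-trans (LEquiv-sym (proj₂ s) e) (swp (LValidSwap-sym lc s) (done λ _ → refl))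

  kempeSwap-connected : φ u ∈⟨ α , β ⟩ → (∀ v → φ v ∈⟨ α , β ⟩ → InComp G φ α β u v) →
                        ψ ≗ swapCol G α β ∘ φ → KempeSwap G φ α β u ψ
  kempeSwap-connected φu connected ψ≗ =
    φu , λ v → (λ _ → ψ≗ v) , λ c∉ → trans (ψ≗ v) (swapCol-other (c∉ ∘ connected v))

  swap-connected : IsLColouring G L φ → φ u ∈⟨ α , β ⟩ → (∀ v → φ v ∈⟨ α , β ⟩ → InComp G φ α β u v) →
                   ψ ≗ swapCol G α β ∘ φ → (∀ v → ψ v ∈ L v) → LEquiv G L φ ψ
  swap-connected {φ = φ} {α = α} {β} {ψ} (_ , proper) φu connected ψ≗ mem =
    swp ((α , β , _ , kempeSwap-connected φu connected ψ≗) , mem , ψ-proper) (done λ _ → refl)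
    where
    ψ-proper : ∀ u v → Adj G u v → ψ u ≢ ψ v
    ψ-proper u v a eq = proper u v a (swapCol-injective α β (trans (sym (ψ≗ u)) (trans eq (ψ≗ v))))

  swap-dominating : (∀ v → v ≢ u → Adj G u v) → IsLColouring G L φ →
                    (∀ v → swapCol G (φ u) α (φ v) ∈ L v) → LEquiv G L φ (swapCol G (φ u) α ∘ φ)
  swap-dominating {u = u} {φ = φ} {α = α} dominates lc mem =
    swap-connected lc (inj₁ refl) connected (λ _ → refl) mem
    where
    connected : ∀ v → φ v ∈⟨ φ u , α ⟩ → InComp G φ (φ u) α u v
    connected v p with v ≟ᶠ u
    ... | yes refl = here p
    ... | no v≢u = step (here (inj₁ refl)) (dominates v v≢u) p

  recolour : IsLColouring G L φ → x ∈ L u → (∀ w → Adj G u w → φ w ≢ x) →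
             ψ ≗ updateAt φ u (const x) → LEquiv G L φ ψ
  recolour {L = L} {φ = φ} {x = x} {u = u} {ψ = ψ} (mem , proper) x∈ x-free ψ≗ =
    swp ((φ u , x , u , inj₁ refl , λ v → inside , outside) , ψ-mem , ψ-proper) (done λ _ → refl)
    where
    ψ-at : ψ u ≡ x
    ψ-at = trans (ψ≗ u) (updateAt-updates u φ)

    ψ-off : ∀ {w} → w ≢ u → ψ w ≡ φ w
    ψ-off w≢u = trans (ψ≗ _) (updateAt-minimal _ u φ w≢u)

    isolated : ∀ {v} → InComp G φ (φ u) x u v → v ≡ u
    isolated (here _) = refl
    isolated (step c a p) with isolated c
    ... | refl with p
    ...   | inj₁ eq = contradiction (sym eq) (proper _ _ a)
    ...   | inj₂ eq = contradiction eq (x-free _ a)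

    inside : ∀ {v} → InComp G φ (φ u) x u v → ψ v ≡ swapCol G (φ u) x (φ v)
    inside c with isolated c
    ... | refl = trans ψ-at (sym (swapCol-left (φ u) x))

    outside : ∀ {v} → ¬ InComp G φ (φ u) x u v → ψ v ≡ φ v
    outside c∉ = ψ-off λ { refl → c∉ (here (inj₁ refl)) }

    ψ-mem : ∀ v → ψ v ∈ L v
    ψ-mem v with v ≟ᶠ u
    ... | yes refl = subst (_∈ L u) (sym ψ-at) x∈
    ... | no v≢u = subst (_∈ L v) (sym (ψ-off v≢u)) (mem v)

    ψ-proper : ∀ v w → Adj G v w → ψ v ≢ ψ w
    ψ-proper v w a with v ≟ᶠ u | w ≟ᶠ u
    ... | yes refl | yes refl = contradiction refl (proper u u a)
    ... | yes refl | no w≢u = λ eq → x-free w a (trans (sym (ψ-off w≢u)) (trans (sym eq) ψ-at))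
    ... | no v≢u | yes refl = λ eq → x-free v (adj-sym a) (trans (sym (ψ-off v≢u)) (trans eq ψ-at))
    ... | no v≢u | no w≢u = λ eq → proper v w a (trans (sym (ψ-off v≢u)) (trans eq (ψ-off w≢u)))

  record Automorphism : Set where
    field
      perm     : Permutation′ n
      adj-perm : ∀ u v → adj (perm ⟨$⟩ʳ u) (perm ⟨$⟩ʳ v) ≡ adj u v

  open Automorphism public

  infixl 9 _∘ᵃ_

  _∘ᵃ_ : {A : Set} → (Fin n → A) → Automorphism → Fin n → A
  f ∘ᵃ σ = f ∘ (perm σ ⟨$⟩ʳ_)

  inverse : Automorphism → Automorphism
  inverse σ = record
    { perm = flip (perm σ)
    ; adj-perm = λ u v → trans (sym (adj-perm σ _ _)) (cong₂ adj (inverseʳ (perm σ)) (inverseʳ (perm σ)))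
    }

  module _ (σ : Automorphism) where
    private
      σ⁻¹ = perm σ ⟨$⟩ˡ_

      adj-σ⁻¹ : Adj G u v → Adj G (σ⁻¹ u) (σ⁻¹ v)
      adj-σ⁻¹ {u} {v} = subst T (sym (adj-perm (inverse σ) u v))

    InComp-∘ᵃ : InComp G φ α β u v → InComp G (φ ∘ᵃ σ) α β (σ⁻¹ u) (σ⁻¹ v)
    InComp-∘ᵃ {φ = φ} {α = α} {β} (here p) = here (subst (_∈⟨ α , β ⟩) (cong φ (sym (inverseʳ (perm σ)))) p)
    InComp-∘ᵃ {φ = φ} {α = α} {β} (step c a p) =
      step (InComp-∘ᵃ c) (adj-σ⁻¹ a) (subst (_∈⟨ α , β ⟩) (cong φ (sym (inverseʳ (perm σ)))) p)

    ∘ᵃ-InComp : InComp G (φ ∘ᵃ σ) α β u v → InComp G φ α β (perm σ ⟨$⟩ʳ u) (perm σ ⟨$⟩ʳ v)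
    ∘ᵃ-InComp (here p) = here p
    ∘ᵃ-InComp (step c a p) = step (∘ᵃ-InComp c) (subst T (sym (adj-perm σ _ _)) a) p

    KempeSwap-∘ᵃ : KempeSwap G φ α β u ψ → KempeSwap G (φ ∘ᵃ σ) α β (σ⁻¹ u) (ψ ∘ᵃ σ)
    KempeSwap-∘ᵃ {φ = φ} {α = α} {β} {u} {ψ} (φu , swapped) =
      subst (_∈⟨ α , β ⟩) (cong φ (sym (inverseʳ (perm σ)))) φu , λ v →
        (λ c → proj₁ (swapped _) (subst (λ w → InComp G φ α β w _) (inverseʳ (perm σ)) (∘ᵃ-InComp c))) ,
        (λ c∉ → proj₂ (swapped _) λ c →
                  c∉ (subst (InComp G (φ ∘ᵃ σ) α β (σ⁻¹ u)) (inverseˡ (perm σ)) (InComp-∘ᵃ c)))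

    IsLColouring-∘ᵃ : IsLColouring G L φ → IsLColouring G (L ∘ᵃ σ) (φ ∘ᵃ σ)
    IsLColouring-∘ᵃ (mem , proper) =
      mem ∘ (perm σ ⟨$⟩ʳ_) , λ u v a → proper _ _ (subst T (sym (adj-perm σ u v)) a)

    LEquiv-∘ᵃ : LEquiv G L φ ψ → LEquiv G (L ∘ᵃ σ) (φ ∘ᵃ σ) (ψ ∘ᵃ σ)
    LEquiv-∘ᵃ (done eq) = done (eq ∘ (perm σ ⟨$⟩ʳ_))
    LEquiv-∘ᵃ (swp ((α , β , u , s) , lc) e) =
      swp ((α , β , σ⁻¹ u , KempeSwap-∘ᵃ s) , IsLColouring-∘ᵃ lc) (LEquiv-∘ᵃ e)

  LEquiv-∘ᵃ⁻ : (σ : Automorphism) → LEquiv G (L ∘ᵃ σ) (φ ∘ᵃ σ) (ψ ∘ᵃ σ) → LEquiv G L φ ψ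
  LEquiv-∘ᵃ⁻ {L} {φ} {ψ} σ e = LEquiv-resp (cancel L) (cancel φ) (cancel ψ) (LEquiv-∘ᵃ (inverse σ) e)
    where
    cancel : {A : Set} (f : Fin n → A) → f ∘ᵃ σ ∘ᵃ inverse σ ≗ f
    cancel f v = cong f (inverseʳ (perm σ))

-- Counting colours in lists

private
  variable
    l xs ys : List ℕ
    x y z : ℕ

pigeonhole : Unique xs → length ys < length xs → ∃ λ x → x ∈ xs × x ∉ ys
pigeonhole {x ∷ xs} {ys} (x∉xs ∷ unique) shorter with x ∈? ys
... | no x∉ys = x , here refl , x∉ys
... | yes x∈ys with ∈-∃++ x∈ys
...   | ys₁ , ys₂ , refl = skip (pigeonhole unique (removed-shorter shorter))
  where
  removed-shorter : length (ys₁ ++ x ∷ ys₂) < suc (length xs) → length (ys₁ ++ ys₂) < length xs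
  removed-shorter (s≤s lt) = subst (_≤ length xs) (length-++-sucʳ ys₁ x ys₂) lt

  skip : (∃ λ z → z ∈ xs × z ∉ ys₁ ++ ys₂) → ∃ λ z → z ∈ x ∷ xs × z ∉ ys₁ ++ x ∷ ys₂
  skip (z , z∈xs , z∉) = z , there z∈xs , [ z∉ ∘ ∈-++⁺ˡ , at-x∷ys₂ ] ∘ ∈-++⁻ ys₁
    where
    at-x∷ys₂ : z ∉ x ∷ ys₂
    at-x∷ys₂ (here z≡x) = All.lookup x∉xs z∈xs (sym z≡x)
    at-x∷ys₂ (there z∈ys₂) = z∉ (∈-++⁺ʳ ys₁ z∈ys₂)

Sized : ℕ → List ℕ → Set
Sized k l = Unique l × length l ≡ k

∈-∉⇒≢ : x ∈ l → y ∉ l → x ≢ y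
∈-∉⇒≢ {l = l} x∈ y∉ x≡y = y∉ (subst (_∈ l) x≡y x∈)

avoid : Sized 3 l → length ys < 3 → ∃ λ e → e ∈ l × e ∉ ys
avoid (unique , len) shorter = pigeonhole unique (subst (_ <_) (sym len) shorter)

avoid₂ : Sized 3 l → ∀ x y → ∃ λ e → e ∈ l × e ≢ x × e ≢ y
avoid₂ sized x y with avoid {ys = x ∷ y ∷ []} sized ≤-refl
... | e , e∈ , e∉ = e , e∈ , e∉ ∘ here , e∉ ∘ there ∘ here

avoid₃-or-∈ : Sized 3 l → ∀ x y z → (∃ λ e → e ∈ l × e ≢ x × e ≢ y × e ≢ z) ⊎ (y ∈ l × z ∈ l × y ≢ z)
avoid₃-or-∈ {l} sized x y z with y ≟ z | y ∈? l | z ∈? l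
... | yes refl | _ | _ = let (e , e∈ , e≢x , e≢y) = avoid₂ sized x y in inj₁ (e , e∈ , e≢x , e≢y , e≢y)
... | no y≢z | yes y∈ | yes z∈ = inj₂ (y∈ , z∈ , y≢z)
... | no _ | no y∉ | _ =
      let (e , e∈ , e≢x , e≢z) = avoid₂ sized x z in inj₁ (e , e∈ , e≢x , ∈-∉⇒≢ e∈ y∉ , e≢z)
... | no _ | yes _ | no z∉ =
      let (e , e∈ , e≢x , e≢y) = avoid₂ sized x y in inj₁ (e , e∈ , e≢x , e≢y , ∈-∉⇒≢ e∈ z∉)

two-avoiding : Sized 3 l → ∀ z → ∃₂ λ p q → p ≢ q × (p ∈ l × p ≢ z) × (q ∈ l × q ≢ z)
two-avoiding sized z with avoid {ys = z ∷ []} sized (s≤s (s≤s z≤n))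
... | p , p∈ , p∉ with avoid₂ sized z p
...   | q , q∈ , q≢z , q≢p = p , q , ≢-sym q≢p , (p∈ , p∉ ∘ here) , (q∈ , q≢z)

-- Two-choosability of the 4-cycle

private
  variable
    p q p₀ q₀ p₁ q₁ p₂ q₂ p₃ q₃ e : ℕ

choose-avoiding : ∀ x → p ≢ q → ∃ λ e → e ∈⟨ p , q ⟩ × e ≢ x
choose-avoiding {p} x p≢q with p ≟ x
... | yes refl = _ , inj₂ refl , ≢-sym p≢q
... | no p≢x = p , inj₁ refl , p≢x

choose-avoiding₂ : ∀ x y → p ≢ q →
  (∃ λ e → e ∈⟨ p , q ⟩ × e ≢ x × e ≢ y) ⊎ (x ∈⟨ p , q ⟩ × y ∈⟨ p , q ⟩ × x ≢ y)
choose-avoiding₂ {p} {q} x y p≢q with p ∈⟨ x , y ⟩? | q ∈⟨ x , y ⟩?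
... | no p∉ | _ = inj₁ (p , inj₁ refl , p∉ ∘ inj₁ , p∉ ∘ inj₂)
... | yes _ | no q∉ = inj₁ (q , inj₂ refl , q∉ ∘ inj₁ , q∉ ∘ inj₂)
... | yes (inj₁ refl) | yes (inj₁ refl) = contradiction refl p≢q
... | yes (inj₁ refl) | yes (inj₂ refl) = inj₂ (inj₁ refl , inj₂ refl , p≢q)
... | yes (inj₂ refl) | yes (inj₁ refl) = inj₂ (inj₂ refl , inj₁ refl , ≢-sym p≢q)
... | yes (inj₂ refl) | yes (inj₂ refl) = contradiction refl p≢q

other : e ∈⟨ p , q ⟩ → p ≢ q → ∃ λ o → o ∈⟨ p , q ⟩ × o ≢ e
other (inj₁ refl) p≢q = _ , inj₂ refl , ≢-sym p≢q
other (inj₂ refl) p≢q = _ , inj₁ refl , p≢q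

cycle₄-choosable : p₀ ≢ q₀ → p₁ ≢ q₁ → p₂ ≢ q₂ → p₃ ≢ q₃ →
  ∃ λ e₀ → ∃ λ e₁ → ∃ λ e₂ → ∃ λ e₃ →
    (e₀ ∈⟨ p₀ , q₀ ⟩ × e₁ ∈⟨ p₁ , q₁ ⟩ × e₂ ∈⟨ p₂ , q₂ ⟩ × e₃ ∈⟨ p₃ , q₃ ⟩) ×
    (e₀ ≢ e₁ × e₁ ≢ e₂ × e₂ ≢ e₃ × e₃ ≢ e₀)
cycle₄-choosable {p₀} {q₀} {p₁} {q₁} {p₂} {q₂} {p₃} {q₃} d₀ d₁ d₂ d₃
  with choose-avoiding p₀ d₁ | choose-avoiding p₀ d₃
... | e₁ , e₁∈ , e₁≢p₀ | e₃ , e₃∈ , e₃≢p₀ with choose-avoiding₂ e₁ e₃ d₂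
...   | inj₁ (e₂ , e₂∈ , e₂≢e₁ , e₂≢e₃) =
        p₀ , e₁ , e₂ , e₃ , (inj₁ refl , e₁∈ , e₂∈ , e₃∈) , (≢-sym e₁≢p₀ , ≢-sym e₂≢e₁ , e₂≢e₃ , e₃≢p₀)
...   | inj₂ (e₁∈₂ , e₃∈₂ , e₁≢e₃) with p₀ ∈⟨ p₁ , q₁ ⟩? | p₀ ∈⟨ p₃ , q₃ ⟩?
...     | no p₀∉₁ | _ = let (o , o∈ , o≢e₁) = other e₁∈ d₁ in
          p₀ , o , e₁ , e₃ , (inj₁ refl , o∈ , e₁∈₂ , e₃∈) ,
          ((λ p₀≡o → p₀∉₁ (subst (_∈⟨ p₁ , q₁ ⟩) (sym p₀≡o) o∈)) , o≢e₁ , e₁≢e₃ , e₃≢p₀)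
...     | yes _ | no p₀∉₃ = let (o , o∈ , o≢e₃) = other e₃∈ d₃ in
          p₀ , e₁ , e₃ , o , (inj₁ refl , e₁∈ , e₃∈₂ , o∈) ,
          (≢-sym e₁≢p₀ , e₁≢e₃ , ≢-sym o≢e₃ , λ o≡p₀ → p₀∉₃ (subst (_∈⟨ p₃ , q₃ ⟩) o≡p₀ o∈))
...     | yes p₀∈₁ | yes p₀∈₃ =
          q₀ , p₀ , e₁ , p₀ , (inj₂ refl , p₀∈₁ , e₁∈₂ , p₀∈₃) , (≢-sym d₀ , ≢-sym e₁≢p₀ , e₁≢p₀ , d₀)

-- The wheel W₄

pattern v₀ = 0F
pattern v₁ = 1F
pattern v₂ = 2F
pattern v₃ = 3F
pattern hub = 4F

w4adj-sym : ∀ u v → w4adj u v ≡ w4adj v u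
w4adj-sym = toWitness {a? = all? λ u → all? λ v → w4adj u v ≟ᵇ w4adj v u} _

w4-symmetric : ∀ {u v} → Adj W4 u v → Adj W4 v u
w4-symmetric {u} {v} = subst T (w4adj-sym u v)

open KempeChains W4 w4-symmetric

private
  variable
    L : ListAssignment W4
    φ ψ : Colouring W4
    a b c d h a′ b′ c′ d′ h′ k s t α : ℕ

on-vertices : {P : Fin 5 → Set} → P v₀ → P v₁ → P v₂ → P v₃ → P hub → ∀ v → P v
on-vertices p₀ p₁ p₂ p₃ p-hub v₀ = p₀
on-vertices p₀ p₁ p₂ p₃ p-hub v₁ = p₁
on-vertices p₀ p₁ p₂ p₃ p-hub v₂ = p₂
on-vertices p₀ p₁ p₂ p₃ p-hub v₃ = p₃
on-vertices p₀ p₁ p₂ p₃ p-hub hub = p-hub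

hub-dominates : ∀ v → v ≢ hub → Adj W4 hub v
hub-dominates = on-vertices _ _ _ _ (λ hub≢hub → contradiction refl hub≢hub)

wheel : ℕ → ℕ → ℕ → ℕ → ℕ → Colouring W4
wheel a b c d h = on-vertices a b c d h

distinct : IsLColouring W4 L φ → ∀ u v → {Adj W4 u v} → φ u ≢ φ v
distinct (_ , proper) u v {uv} = proper u v uv

wheel-colouring : a ∈ L v₀ → b ∈ L v₁ → c ∈ L v₂ → d ∈ L v₃ → h ∈ L hub →
                  a ≢ b → b ≢ c → c ≢ d → d ≢ a → a ≢ h → b ≢ h → c ≢ h → d ≢ h →
                  IsLColouring W4 L (wheel a b c d h)
wheel-colouring {a = a} {b = b} {c = c} {d = d} {h = h} a∈ b∈ c∈ d∈ h∈ ab bc cd da ah bh ch dh =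
  on-vertices a∈ b∈ c∈ d∈ h∈ , proper
  where
  proper : ∀ u v → Adj W4 u v → wheel a b c d h u ≢ wheel a b c d h v
  proper v₀ v₀ ()
  proper v₀ v₁ _ = ab
  proper v₀ v₂ ()
  proper v₀ v₃ _ = ≢-sym da
  proper v₀ hub _ = ah
  proper v₁ v₀ _ = ≢-sym ab
  proper v₁ v₁ ()
  proper v₁ v₂ _ = bc
  proper v₁ v₃ ()
  proper v₁ hub _ = bh
  proper v₂ v₀ ()
  proper v₂ v₁ _ = ≢-sym bc
  proper v₂ v₂ ()
  proper v₂ v₃ _ = cd
  proper v₂ hub _ = ch
  proper v₃ v₀ _ = da
  proper v₃ v₁ ()
  proper v₃ v₂ _ = ≢-sym cd
  proper v₃ v₃ ()
  proper v₃ hub _ = dh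
  proper hub v₀ _ = ≢-sym ah
  proper hub v₁ _ = ≢-sym bh
  proper hub v₂ _ = ≢-sym ch
  proper hub v₃ _ = ≢-sym dh
  proper hub hub ()

RimOfSize3 : ListAssignment W4 → Set
RimOfSize3 L = ∀ v → v ≢ hub → Sized 3 (L v)

RimOfSize3-∘ᵃ : (σ : Automorphism) → perm σ ⟨$⟩ˡ hub ≡ hub → RimOfSize3 L → RimOfSize3 (L ∘ᵃ σ)
RimOfSize3-∘ᵃ σ fixes-hub rim v v≢hub = rim _ λ σv≡hub →
  v≢hub (trans (sym (inverseˡ (perm σ))) (trans (cong (perm σ ⟨$⟩ˡ_) σv≡hub) fixes-hub))

preserves-w4adj? : (π : Permutation′ 5) → Dec (∀ u v → w4adj (π ⟨$⟩ʳ u) (π ⟨$⟩ʳ v) ≡ w4adj u v)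
preserves-w4adj? π = all? λ u → all? λ v → w4adj (π ⟨$⟩ʳ u) (π ⟨$⟩ʳ v) ≟ᵇ w4adj u v

w4-automorphism : (π : Permutation′ 5) → True (preserves-w4adj? π) → Automorphism
w4-automorphism π preserves = record { perm = π ; adj-perm = toWitness preserves }

-- reflectᵢⱼ is the reflection of the rim square that maps vᵢ to vⱼ.
reflect₀₂ reflect₁₃ reflect₁₂ reflect₁₀ : Automorphism
reflect₀₂ = w4-automorphism (transpose v₀ v₂) _
reflect₁₃ = w4-automorphism (transpose v₁ v₃) _
reflect₁₂ = w4-automorphism (transpose v₁ v₂ ∘ₚ transpose v₀ v₃) _
reflect₁₀ = w4-automorphism (transpose v₁ v₀ ∘ₚ transpose v₂ v₃) _

recolour-v₀ : IsLColouring W4 L (wheel a b c d h) → k ∈ L v₀ → b ≢ k → d ≢ k → h ≢ k →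
              LEquiv W4 L (wheel a b c d h) (wheel k b c d h)
recolour-v₀ lc k∈ b≢k d≢k h≢k =
  recolour lc k∈ (on-vertices (λ ()) (λ _ → b≢k) (λ ()) (λ _ → d≢k) (λ _ → h≢k))
                 (on-vertices refl refl refl refl refl)

recolour-v₁ : IsLColouring W4 L (wheel a b c d h) → k ∈ L v₁ → a ≢ k → c ≢ k → h ≢ k →
              LEquiv W4 L (wheel a b c d h) (wheel a k c d h)
recolour-v₁ lc k∈ a≢k c≢k h≢k =
  recolour lc k∈ (on-vertices (λ _ → a≢k) (λ ()) (λ _ → c≢k) (λ ()) (λ _ → h≢k))
                 (on-vertices refl refl refl refl refl)

recolour-v₃ : IsLColouring W4 L (wheel a b c d h) → k ∈ L v₃ → a ≢ k → c ≢ k → h ≢ k →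
              LEquiv W4 L (wheel a b c d h) (wheel a b c k h)
recolour-v₃ lc k∈ a≢k c≢k h≢k =
  recolour lc k∈ (on-vertices (λ _ → a≢k) (λ ()) (λ _ → c≢k) (λ ()) (λ _ → h≢k))
                 (on-vertices refl refl refl refl refl)

reflect₀₂-colouring : IsLColouring W4 L (wheel a b c d h) → IsLColouring W4 (L ∘ᵃ reflect₀₂) (wheel c b a d h)
reflect₀₂-colouring lc =
  IsLColouring-resp (λ _ → refl) (on-vertices refl refl refl refl refl) (IsLColouring-∘ᵃ reflect₀₂ lc)

reflect₀₂-equiv : LEquiv W4 (L ∘ᵃ reflect₀₂) (wheel c b a d h) (wheel c′ b′ a′ d′ h′) →
                  LEquiv W4 L (wheel a b c d h) (wheel a′ b′ c′ d′ h′)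
reflect₀₂-equiv e = LEquiv-∘ᵃ⁻ reflect₀₂
  (LEquiv-resp (λ _ → refl) (on-vertices refl refl refl refl refl) (on-vertices refl refl refl refl refl) e)

-- Colourings with a fixed hub colour

-- When v₁ already has colour k, move it out of the way; if L v₁ = {a, b, c} leaves no
-- room for that, the (a, b)-swap on the edge v₀v₁ recolours v₀ instead.
move-v₀ : RimOfSize3 L → h ∉ L v₁ → IsLColouring W4 L (wheel a b c d h) → k ∈ L v₀ → k ≢ d → k ≢ h →
          ∃ λ b′ → LEquiv W4 L (wheel a b c d h) (wheel k b′ c d h)
move-v₀ {L} {h} {a} {b} {c} {d} {k} rim h∉ lc k∈ k≢d k≢h with b ≟ k
... | no b≢k = b , recolour-v₀ lc k∈ b≢k (≢-sym k≢d) (≢-sym k≢h)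
... | yes refl with avoid₃-or-∈ (rim v₁ (λ ())) b a c
...   | inj₁ (e , e∈ , e≢b , e≢a , e≢c) =
        e , LEquiv-trans v₁-moved (recolour-v₀ (LEquiv-colouring lc v₁-moved) k∈ e≢b (≢-sym k≢d) (≢-sym k≢h))
    where
    v₁-moved : LEquiv W4 L (wheel a b c d h) (wheel a e c d h)
    v₁-moved = recolour-v₁ lc e∈ (≢-sym e≢a) (≢-sym e≢c) (≢-sym (∈-∉⇒≢ e∈ h∉))
...   | inj₂ (a∈ , _ , a≢c) =
        a , swap-connected lc (inj₁ refl) connected swapped
                           (on-vertices k∈ a∈ (proj₁ lc v₂) (proj₁ lc v₃) (proj₁ lc hub))
  where
  c∉ : ¬ c ∈⟨ a , b ⟩
  c∉ = [ ≢-sym a≢c , distinct lc v₂ v₁ ]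
  d∉ : ¬ d ∈⟨ a , b ⟩
  d∉ = [ distinct lc v₃ v₀ , ≢-sym k≢d ]
  h∉ab : ¬ h ∈⟨ a , b ⟩
  h∉ab = [ distinct lc hub v₀ , distinct lc hub v₁ ]
  connected : ∀ v → wheel a b c d h v ∈⟨ a , b ⟩ → InComp W4 (wheel a b c d h) a b v₀ v
  connected = on-vertices here (step (here (inj₁ refl)) _) (⊥-elim ∘ c∉) (⊥-elim ∘ d∉) (⊥-elim ∘ h∉ab)
  swapped : wheel b a c d h ≗ swapCol W4 a b ∘ wheel a b c d h
  swapped = on-vertices (sym (swapCol-left a b)) (sym (swapCol-right a b))
                        (sym (swapCol-other c∉)) (sym (swapCol-other d∉)) (sym (swapCol-other h∉ab))

move-v₂ : RimOfSize3 L → h ∉ L v₁ → IsLColouring W4 L (wheel a b c d h) → k ∈ L v₂ → k ≢ d → k ≢ h →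
          ∃ λ b′ → LEquiv W4 L (wheel a b c d h) (wheel a b′ k d h)
move-v₂ rim h∉ lc k∈ k≢d k≢h =
  let (b′ , e) = move-v₀ (RimOfSize3-∘ᵃ reflect₀₂ refl rim) h∉ (reflect₀₂-colouring lc) k∈ k≢d k≢h
  in b′ , reflect₀₂-equiv e

agree-on-v₃ : RimOfSize3 L → h ∉ L v₁ →
              IsLColouring W4 L (wheel a b c d h) → IsLColouring W4 L (wheel a′ b′ c′ d h) →
              LEquiv W4 L (wheel a b c d h) (wheel a′ b′ c′ d h)
agree-on-v₃ rim h∉ lc lc′ =
  let (_ , e₀) = move-v₀ rim h∉ lc (proj₁ lc′ v₀) (distinct lc′ v₀ v₃) (distinct lc′ v₀ hub)
      (_ , e₂) = move-v₂ rim h∉ (LEquiv-colouring lc e₀) (proj₁ lc′ v₂)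
                         (distinct lc′ v₂ v₃) (distinct lc′ v₂ hub)
      e₁ = recolour-v₁ (LEquiv-colouring (LEquiv-colouring lc e₀) e₂) (proj₁ lc′ v₁)
             (distinct lc′ v₀ v₁) (distinct lc′ v₂ v₁) (distinct lc′ hub v₁)
  in LEquiv-trans e₀ (LEquiv-trans e₂ e₁)

move-v₃-directly : RimOfSize3 L → h ∉ L v₁ → IsLColouring W4 L (wheel a b c s h) → t ∈ L v₃ → t ≢ h →
                   a′ ∈ L v₀ → a′ ≢ h → a′ ≢ s → a′ ≢ t → c′ ∈ L v₂ → c′ ≢ h → c′ ≢ s → c′ ≢ t →
                   ∃ λ b′ → LEquiv W4 L (wheel a b c s h) (wheel a′ b′ c′ t h)
move-v₃-directly {L} {h} {a} {b} {c} {s} {t} {a′} {c′} rim h∉ lc t∈ t≢h a′∈ a′≢h a′≢s a′≢t c′∈ c′≢h c′≢s c′≢t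
  with avoid₂ (rim v₁ (λ ())) a′ c′
... | b′ , b′∈ , b′≢a′ , b′≢c′ =
      b′ , LEquiv-trans (agree-on-v₃ rim h∉ lc lσ) (recolour-v₃ lσ t∈ a′≢t c′≢t (≢-sym t≢h))
  where
  lσ : IsLColouring W4 L (wheel a′ b′ c′ s h)
  lσ = wheel-colouring a′∈ b′∈ c′∈ (proj₁ lc v₃) (proj₁ lc hub) (≢-sym b′≢a′) b′≢c′ c′≢s (≢-sym a′≢s)
                       a′≢h (∈-∉⇒≢ b′∈ h∉) c′≢h (distinct lc v₃ hub)

-- For the case L v₀ = {h, s, t}: v₀ must carry t before the (s, t)-swap at v₃.
move-v₃-across-v₀ : RimOfSize3 L → h ∉ L v₁ → IsLColouring W4 L (wheel a b c s h) → t ∈ L v₃ → t ≢ h → t ≢ s →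
                    s ∈ L v₀ → t ∈ L v₀ → c′ ∈ L v₂ → c′ ≢ h → c′ ≢ s → c′ ≢ t →
                    ∃ λ b′ → LEquiv W4 L (wheel a b c s h) (wheel s b′ c′ t h)
move-v₃-across-v₀ {L} {h} {a} {b} {c} {s} {t} {c′} rim h∉ lc t∈ t≢h t≢s s∈₀ t∈₀ c′∈ c′≢h c′≢s c′≢t
  with avoid₃-or-∈ (rim v₁ (λ ())) c′ s t
... | inj₁ (b′ , b′∈ , b′≢c′ , b′≢s , b′≢t) =
      b′ , LEquiv-trans (agree-on-v₃ rim h∉ lc lσ) (swap-connected lσ (inj₁ refl) connected swapped mem)
  where
  lσ : IsLColouring W4 L (wheel t b′ c′ s h)
  lσ = wheel-colouring t∈₀ b′∈ c′∈ (proj₁ lc v₃) (proj₁ lc hub) (≢-sym b′≢t) b′≢c′ c′≢s (≢-sym t≢s)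
                       t≢h (∈-∉⇒≢ b′∈ h∉) c′≢h (distinct lc v₃ hub)
  b′∉ : ¬ b′ ∈⟨ s , t ⟩
  b′∉ = [ b′≢s , b′≢t ]
  c′∉ : ¬ c′ ∈⟨ s , t ⟩
  c′∉ = [ c′≢s , c′≢t ]
  h∉st : ¬ h ∈⟨ s , t ⟩
  h∉st = [ distinct lc hub v₃ , ≢-sym t≢h ]
  connected : ∀ v → wheel t b′ c′ s h v ∈⟨ s , t ⟩ → InComp W4 (wheel t b′ c′ s h) s t v₃ v
  connected = on-vertices (step (here (inj₁ refl)) _) (⊥-elim ∘ b′∉) (⊥-elim ∘ c′∉) here (⊥-elim ∘ h∉st)
  swapped : wheel s b′ c′ t h ≗ swapCol W4 s t ∘ wheel t b′ c′ s h
  swapped = on-vertices (sym (swapCol-right s t)) (sym (swapCol-other b′∉)) (sym (swapCol-other c′∉))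
                        (sym (swapCol-left s t)) (sym (swapCol-other h∉st))
  mem : ∀ v → wheel s b′ c′ t h v ∈ L v
  mem = on-vertices s∈₀ b′∈ c′∈ t∈ (proj₁ lc hub)
... | inj₂ (s∈₁ , t∈₁ , _) =
      t , LEquiv-trans (agree-on-v₃ rim h∉ lc lσ) (swap-connected lσ (inj₁ refl) connected swapped mem)
  where
  lσ : IsLColouring W4 L (wheel t s c′ s h)
  lσ = wheel-colouring t∈₀ s∈₁ c′∈ (proj₁ lc v₃) (proj₁ lc hub) t≢s (≢-sym c′≢s) c′≢s (≢-sym t≢s)
                       t≢h (distinct lc v₃ hub) c′≢h (distinct lc v₃ hub)
  c′∉ : ¬ c′ ∈⟨ s , t ⟩
  c′∉ = [ c′≢s , c′≢t ]
  h∉st : ¬ h ∈⟨ s , t ⟩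
  h∉st = [ distinct lc hub v₃ , ≢-sym t≢h ]
  connected : ∀ v → wheel t s c′ s h v ∈⟨ s , t ⟩ → InComp W4 (wheel t s c′ s h) s t v₃ v
  connected = on-vertices (step (here (inj₁ refl)) _) (step (step (here (inj₁ refl)) _ (inj₂ refl)) _)
                          (⊥-elim ∘ c′∉) here (⊥-elim ∘ h∉st)
  swapped : wheel s t c′ t h ≗ swapCol W4 s t ∘ wheel t s c′ s h
  swapped = on-vertices (sym (swapCol-right s t)) (sym (swapCol-left s t)) (sym (swapCol-other c′∉))
                        (sym (swapCol-left s t)) (sym (swapCol-other h∉st))
  mem : ∀ v → wheel s t c′ t h v ∈ L v
  mem = on-vertices s∈₀ t∈₁ c′∈ t∈ (proj₁ lc hub)

move-v₃-across-v₀-v₂ : RimOfSize3 L → h ∉ L v₁ → IsLColouring W4 L (wheel a b c s h) →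
                       t ∈ L v₃ → t ≢ h → t ≢ s →
                       s ∈ L v₀ → t ∈ L v₀ → s ∈ L v₂ → t ∈ L v₂ →
                       ∃ λ b′ → LEquiv W4 L (wheel a b c s h) (wheel s b′ s t h)
move-v₃-across-v₀-v₂ {L} {h} {a} {b} {c} {s} {t} rim h∉ lc t∈ t≢h t≢s s∈₀ t∈₀ s∈₂ t∈₂
  with avoid₂ (rim v₁ (λ ())) s t
... | b′ , b′∈ , b′≢s , b′≢t =
      b′ , LEquiv-trans (agree-on-v₃ rim h∉ lc lσ) (swap-connected lσ (inj₁ refl) connected swapped mem)
  where
  lσ : IsLColouring W4 L (wheel t b′ t s h)
  lσ = wheel-colouring t∈₀ b′∈ t∈₂ (proj₁ lc v₃) (proj₁ lc hub) (≢-sym b′≢t) b′≢t t≢s (≢-sym t≢s)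
                       t≢h (∈-∉⇒≢ b′∈ h∉) t≢h (distinct lc v₃ hub)
  b′∉ : ¬ b′ ∈⟨ s , t ⟩
  b′∉ = [ b′≢s , b′≢t ]
  h∉st : ¬ h ∈⟨ s , t ⟩
  h∉st = [ distinct lc hub v₃ , ≢-sym t≢h ]
  connected : ∀ v → wheel t b′ t s h v ∈⟨ s , t ⟩ → InComp W4 (wheel t b′ t s h) s t v₃ v
  connected = on-vertices (step (here (inj₁ refl)) _) (⊥-elim ∘ b′∉) (step (here (inj₁ refl)) _)
                          here (⊥-elim ∘ h∉st)
  swapped : wheel s b′ s t h ≗ swapCol W4 s t ∘ wheel t b′ t s h
  swapped = on-vertices (sym (swapCol-right s t)) (sym (swapCol-other b′∉)) (sym (swapCol-right s t))
                        (sym (swapCol-left s t)) (sym (swapCol-other h∉st))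
  mem : ∀ v → wheel s b′ s t h v ∈ L v
  mem = on-vertices s∈₀ b′∈ s∈₂ t∈ (proj₁ lc hub)

move-v₃ : RimOfSize3 L → h ∉ L v₁ → IsLColouring W4 L (wheel a b c s h) → t ∈ L v₃ → t ≢ h → t ≢ s →
          ∃ λ a′ → ∃ λ b′ → ∃ λ c′ → LEquiv W4 L (wheel a b c s h) (wheel a′ b′ c′ t h)
move-v₃ {h = h} {s = s} {t} rim h∉ lc t∈ t≢h t≢s
  with avoid₃-or-∈ (rim v₀ (λ ())) h s t | avoid₃-or-∈ (rim v₂ (λ ())) h s t
... | inj₁ (a′ , a′∈ , a′≢h , a′≢s , a′≢t) | inj₁ (c′ , c′∈ , c′≢h , c′≢s , c′≢t) =
      let (b′ , e) = move-v₃-directly rim h∉ lc t∈ t≢h a′∈ a′≢h a′≢s a′≢t c′∈ c′≢h c′≢s c′≢t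
      in a′ , b′ , c′ , e
... | inj₂ (s∈₀ , t∈₀ , _) | inj₁ (c′ , c′∈ , c′≢h , c′≢s , c′≢t) =
      let (b′ , e) = move-v₃-across-v₀ rim h∉ lc t∈ t≢h t≢s s∈₀ t∈₀ c′∈ c′≢h c′≢s c′≢t
      in s , b′ , c′ , e
... | inj₁ (a′ , a′∈ , a′≢h , a′≢s , a′≢t) | inj₂ (s∈₂ , t∈₂ , _) =
      let (b′ , e) = move-v₃-across-v₀ (RimOfSize3-∘ᵃ reflect₀₂ refl rim) h∉ (reflect₀₂-colouring lc)
                                       t∈ t≢h t≢s s∈₂ t∈₂ a′∈ a′≢h a′≢s a′≢t
      in a′ , b′ , s , reflect₀₂-equiv e
... | inj₂ (s∈₀ , t∈₀ , _) | inj₂ (s∈₂ , t∈₂ , _) =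
      let (b′ , e) = move-v₃-across-v₀-v₂ rim h∉ lc t∈ t≢h t≢s s∈₀ t∈₀ s∈₂ t∈₂
      in s , b′ , s , e

same-hub-equivalent-wheel : RimOfSize3 L → h ∉ L v₁ →
                            IsLColouring W4 L (wheel a b c d h) → IsLColouring W4 L (wheel a′ b′ c′ d′ h) →
                            LEquiv W4 L (wheel a b c d h) (wheel a′ b′ c′ d′ h)
same-hub-equivalent-wheel {d = d} {d′ = d′} rim h∉ lc lc′ with d′ ≟ d
... | yes refl = agree-on-v₃ rim h∉ lc lc′
... | no d′≢d =
      let (_ , _ , _ , e) = move-v₃ rim h∉ lc (proj₁ lc′ v₃) (distinct lc′ v₃ hub) d′≢d
      in LEquiv-trans e (agree-on-v₃ rim h∉ (LEquiv-colouring lc e) lc′)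

same-hub-equivalent-v₁ : RimOfSize3 L → φ hub ∉ L v₁ → IsLColouring W4 L φ → IsLColouring W4 L ψ →
                         φ hub ≡ ψ hub → LEquiv W4 L φ ψ
same-hub-equivalent-v₁ {φ = φ} {ψ} rim h∉ lφ lψ same-hub =
  LEquiv-resp (λ _ → refl) (sym ∘ φ≗) (sym ∘ ψ≗)
    (same-hub-equivalent-wheel rim h∉ (IsLColouring-resp (λ _ → refl) φ≗ lφ)
                                      (IsLColouring-resp (λ _ → refl) ψ≗ lψ))
  where
  φ≗ : φ ≗ wheel (φ v₀) (φ v₁) (φ v₂) (φ v₃) (φ hub)
  φ≗ = on-vertices refl refl refl refl refl
  ψ≗ : ψ ≗ wheel (ψ v₀) (ψ v₁) (ψ v₂) (ψ v₃) (φ hub)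
  ψ≗ = on-vertices refl refl refl refl (sym same-hub)

same-hub-equivalent-via : (σ : Automorphism) → perm σ ⟨$⟩ˡ hub ≡ hub → RimOfSize3 L →
                          (φ ∘ᵃ σ) hub ∉ (L ∘ᵃ σ) v₁ → IsLColouring W4 L φ → IsLColouring W4 L ψ →
                          (φ ∘ᵃ σ) hub ≡ (ψ ∘ᵃ σ) hub → LEquiv W4 L φ ψ
same-hub-equivalent-via σ fixes-hub rim h∉ lφ lψ same-hub =
  LEquiv-∘ᵃ⁻ σ (same-hub-equivalent-v₁ (RimOfSize3-∘ᵃ σ fixes-hub rim) h∉
                                       (IsLColouring-∘ᵃ σ lφ) (IsLColouring-∘ᵃ σ lψ) same-hub)

same-hub-equivalent : RimOfSize3 L → ∀ w → w ≢ hub → φ hub ∉ L w →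
                      IsLColouring W4 L φ → IsLColouring W4 L ψ → φ hub ≡ ψ hub → LEquiv W4 L φ ψ
same-hub-equivalent rim v₀ _ = same-hub-equivalent-via reflect₁₀ refl rim
same-hub-equivalent rim v₁ _ = same-hub-equivalent-v₁ rim
same-hub-equivalent rim v₂ _ = same-hub-equivalent-via reflect₁₂ refl rim
same-hub-equivalent rim v₃ _ = same-hub-equivalent-via reflect₁₃ refl rim
same-hub-equivalent rim hub hub≢hub = contradiction refl hub≢hub

-- Moving the hub colour

hub-swap : IsLColouring W4 L φ → α ∈ L hub → (∀ v → v ≢ hub → φ v ≡ α → φ hub ∈ L v) →
           LEquiv W4 L φ (swapCol W4 (φ hub) α ∘ φ)
hub-swap {L} {φ} {α} lc α∈ hub-colour-allowed = swap-dominating hub-dominates lc mem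
  where
  mem : ∀ v → swapCol W4 (φ hub) α (φ v) ∈ L v
  mem v with v ≟ᶠ hub
  ... | yes refl = subst (_∈ L hub) (sym (swapCol-left (φ hub) α)) α∈
  ... | no v≢hub with φ v ≟ α
  ...   | yes φv≡α = subst (_∈ L v) (sym (trans (cong (swapCol W4 (φ hub) α) φv≡α) (swapCol-right (φ hub) α)))
                           (hub-colour-allowed v v≢hub φv≡α)
  ...   | no φv≢α = subst (_∈ L v) (sym (swapCol-other [ rim≢hub , φv≢α ])) (proj₁ lc v)
    where
    rim≢hub : φ v ≢ φ hub
    rim≢hub = proj₂ lc v hub (w4-symmetric (hub-dominates v v≢hub))

-- A rim colour e under hub colour x that survives the (x, α)-swap at the hub.
record Admissible (L : ListAssignment W4) (x α : ℕ) (v : Fin 5) (e : ℕ) : Set where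
  field
    listed      : e ∈ L v
    avoids-hub  : e ≢ x
    hub-movable : e ≡ α → x ∈ L v

open Admissible

admissible-pair : RimOfSize3 L → ∀ v → v ≢ hub → ∀ x α →
                  ∃₂ λ p q → p ≢ q × (∀ {e} → e ∈⟨ p , q ⟩ → Admissible L x α v e)
admissible-pair {L} rim v v≢hub x α with x ∈? L v
... | yes x∈ =
      let (p , q , p≢q , (p∈ , p≢x) , (q∈ , q≢x)) = two-avoiding (rim v v≢hub) x
      in p , q , p≢q , λ where
           (inj₁ refl) → record { listed = p∈ ; avoids-hub = p≢x ; hub-movable = const x∈ }
           (inj₂ refl) → record { listed = q∈ ; avoids-hub = q≢x ; hub-movable = const x∈ }
... | no x∉ =
      let (p , q , p≢q , (p∈ , p≢α) , (q∈ , q≢α)) = two-avoiding (rim v v≢hub) α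
      in p , q , p≢q , λ where
           (inj₁ refl) → record { listed = p∈ ; avoids-hub = ∈-∉⇒≢ p∈ x∉ ; hub-movable = ⊥-elim ∘ p≢α }
           (inj₂ refl) → record { listed = q∈ ; avoids-hub = ∈-∉⇒≢ q∈ x∉ ; hub-movable = ⊥-elim ∘ q≢α }

hub-swappable-colouring : RimOfSize3 L → h ∈ L hub → ∀ α →
                          ∃ λ σ → IsLColouring W4 L σ × σ hub ≡ h × (∀ v → v ≢ hub → σ v ≡ α → h ∈ L v)
hub-swappable-colouring {L} {h} rim h∈ α
  with admissible-pair rim v₀ (λ ()) h α | admissible-pair rim v₁ (λ ()) h α
     | admissible-pair rim v₂ (λ ()) h α | admissible-pair rim v₃ (λ ()) h α
... | _ , _ , d₀ , A₀ | _ , _ , d₁ , A₁ | _ , _ , d₂ , A₂ | _ , _ , d₃ , A₃ with cycle₄-choosable d₀ d₁ d₂ d₃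
... | e₀ , e₁ , e₂ , e₃ , (i₀ , i₁ , i₂ , i₃) , (n₀₁ , n₁₂ , n₂₃ , n₃₀) =
      wheel e₀ e₁ e₂ e₃ h ,
      wheel-colouring (listed a₀) (listed a₁) (listed a₂) (listed a₃) h∈ n₀₁ n₁₂ n₂₃ n₃₀
                      (avoids-hub a₀) (avoids-hub a₁) (avoids-hub a₂) (avoids-hub a₃) ,
      refl ,
      on-vertices (λ _ → hub-movable a₀) (λ _ → hub-movable a₁) (λ _ → hub-movable a₂) (λ _ → hub-movable a₃)
                  (λ hub≢hub → contradiction refl hub≢hub)
  where
  a₀ : Admissible L h α v₀ e₀
  a₀ = A₀ i₀
  a₁ : Admissible L h α v₁ e₁
  a₁ = A₁ i₁
  a₂ : Admissible L h α v₂ e₂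
  a₂ = A₂ i₂
  a₃ : Admissible L h α v₃ e₃
  a₃ = A₃ i₃

rim-contains? : (L : ListAssignment W4) (x : ℕ) → (∀ v → v ≢ hub → x ∈ L v) ⊎ (∃ λ w → w ≢ hub × x ∉ L w)
rim-contains? L x with x ∈? L v₀ | x ∈? L v₁ | x ∈? L v₂ | x ∈? L v₃
... | no x∉ | _ | _ | _ = inj₂ (v₀ , (λ ()) , x∉)
... | yes _ | no x∉ | _ | _ = inj₂ (v₁ , (λ ()) , x∉)
... | yes _ | yes _ | no x∉ | _ = inj₂ (v₂ , (λ ()) , x∉)
... | yes _ | yes _ | yes _ | no x∉ = inj₂ (v₃ , (λ ()) , x∉)
... | yes x∈₀ | yes x∈₁ | yes x∈₂ | yes x∈₃ =
      inj₁ (on-vertices (λ _ → x∈₀) (λ _ → x∈₁) (λ _ → x∈₂) (λ _ → x∈₃)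
                        (λ hub≢hub → contradiction refl hub≢hub))

move-hub : RimOfSize3 L → α ∈ L hub → IsLColouring W4 L φ → ∃ λ χ → LEquiv W4 L φ χ × χ hub ≡ α
move-hub {L} {α} {φ} rim α∈ lc with rim-contains? L (φ hub)
... | inj₁ everywhere = _ , hub-swap lc α∈ (λ v v≢hub _ → everywhere v v≢hub) , swapCol-left (φ hub) α
... | inj₂ (w , w≢hub , hub∉) =
      let (σ , lσ , σ-hub , σ-admissible) = hub-swappable-colouring rim (proj₁ lc hub) α
      in _ , LEquiv-trans (same-hub-equivalent rim w w≢hub hub∉ lc lσ (sym σ-hub))
                          (hub-swap lσ α∈ λ v v≢hub σv≡α →
                             subst (_∈ L v) (sym σ-hub) (σ-admissible v v≢hub σv≡α)) ,
         swapCol-left (σ hub) α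

lemma12 : DegreeSwappable W4
lemma12 L (unique , size) = colourable , equivalent
  where
  rim : RimOfSize3 L
  rim = on-vertices (λ _ → unique v₀ , size v₀) (λ _ → unique v₁ , size v₁) (λ _ → unique v₂ , size v₂)
                    (λ _ → unique v₃ , size v₃) (λ hub≢hub → contradiction refl hub≢hub)

  fresh : ∃ λ α → α ∈ L hub × α ∉ L v₁
  fresh = pigeonhole (unique hub) (subst₂ _<_ (sym (size v₁)) (sym (size hub)) ≤-refl)

  colourable : ∃ λ φ → IsLColouring W4 L φ
  colourable = let (α , α∈ , _) = fresh ; (σ , lσ , _) = hub-swappable-colouring rim α∈ α in σ , lσ

  equivalent : ∀ φ ψ → IsLColouring W4 L φ → IsLColouring W4 L ψ → LEquiv W4 L φ ψ
  equivalent φ ψ lφ lψ =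
    let (α , α∈ , α∉) = fresh
        (χ , φ~χ , χ-hub) = move-hub rim α∈ lφ
        (χ′ , ψ~χ′ , χ′-hub) = move-hub rim α∈ lψ
    in LEquiv-trans φ~χ (LEquiv-trans
         (same-hub-equivalent-v₁ rim (subst (_∉ L v₁) (sym χ-hub) α∉)
                                 (LEquiv-colouring lφ φ~χ) (LEquiv-colouring lψ ψ~χ′) (trans χ-hub (sym χ′-hub)))
         (LEquiv-sym lψ ψ~χ′))
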